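{- Let $S\in\{O,F\}$ and let $G$ be an S-admissible graph without isolated vertices. Then $\gamma^{\rm STD}(G)\le\gamma^{\rm S}(G)+1$.
   Context: Let $G=(V,E)$ be a finite simple graph, $N(v)$ the open and $N[v]=N(v)\cup\{v\}$ the closed neighborhood of $v$. A set $C\subseteq V$ is: a total-dominating set if $N(v)\cap C\neq\emptyset$ for all $v\in V$; an open-separating set (O-set) if the sets $N(v)\cap C$, $v\in V$, are pairwise distinct; a full-separating set (F-set) if moreover the sets $N[v]\cap C$, $v\in V$, are pairwise distinct as well. $G$ is O-admissible if it has an O-set (equivalently, no two non-adjacent vertices have equal open neighborhoods), and F-admissible if it has an F-set (equivalently, additionally no two adjacent vertices have equal closed neighborhoods). An STD-code is a set that is both an S-set and a total-dominating set. $\gamma^{\rm S}(G)$ and $\gamma^{\rm STD}(G)$ denote the minimum cardinalities of an S-set and of an STD-code of $G$, respectively. -}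

module Defs where

open import Data.Nat using (ℕ; _≤_; _+_)
open import Data.Fin using (Fin)
open import Data.Fin.Subset using (Subset; _∈_; ∣_∣)
open import Data.Product using (Σ; _×_; ∃)
open import Relation.Nullary using (¬_; Dec)
open import Relation.Binary.PropositionalEquality using (_≡_)

record Graph (n : ℕ) : Set₁ where
  field
    Adj   : Fin n → Fin n → Set
    adj?  : ∀ u v → Dec (Adj u v)
    sym   : ∀ {u v} → Adj u v → Adj v u
    irrefl : ∀ {v} → ¬ Adj v v

module _ {n : ℕ} (G : Graph n) where
  open Graph G

  Isolated : Fin n → Set
  Isolated v = ∀ u → ¬ Adj v u

  NoIsolated : Set
  NoIsolated = ∀ v → ¬ Isolated v

  SameOpen : Subset n → Fin n → Fin n → Set
  SameOpen C v w = ∀ u → u ∈ C → (Adj v u → Adj w u) × (Adj w u → Adj v u)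

  ClosedNbr : Fin n → Fin n → Set
  ClosedNbr v u = (u ≡ v) Data.Sum.⊎ Adj v u
    where import Data.Sum

  SameClosed : Subset n → Fin n → Fin n → Set
  SameClosed C v w = ∀ u → u ∈ C →
    (ClosedNbr v u → ClosedNbr w u) × (ClosedNbr w u → ClosedNbr v u)

  TotalDominating : Subset n → Set
  TotalDominating C = ∀ v → ∃ λ u → Adj v u × u ∈ C

  OSet : Subset n → Set
  OSet C = ∀ v w → SameOpen C v w → v ≡ w

  FSet : Subset n → Set
  FSet C = OSet C × (∀ v w → SameClosed C v w → v ≡ w)

data Sep : Set where
  O F : Sep

module _ {n : ℕ} (G : Graph n) where

  SSet : Sep → Subset n → Set
  SSet O C = OSet G C
  SSet F C = FSet G C

  Admissible : Sep → Set
  Admissible S = ∃ λ C → SSet S C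

  STDCode : Sep → Subset n → Set
  STDCode S C = SSet S C × TotalDominating G C

  IsMinCard : (Subset n → Set) → ℕ → Set
  IsMinCard P k = (∃ λ C → P C × ∣ C ∣ ≡ k) × (∀ C → P C → k ≤ ∣ C ∣)

  γS : Sep → ℕ → Set
  γS S k = IsMinCard (SSet S) k

  γSTD : Sep → ℕ → Set
  γSTD S m = IsMinCard (STDCode S) m

{-# OPTIONS --safe #-}
module Submission where

-- An S-set C already separates every pair of vertices, so it fails to be total-dominating
-- only at vertices v with N(v) ∩ C = ∅. Two such vertices have the same (empty) trace on C
-- and hence coincide: at most one vertex is undominated, and adding one neighbour of it to C
-- gives an STD-code. Minimum cardinalities exist because S-sets and STD-codes are decidable
-- properties of subsets of a finite set.

open import Defs
open import Data.Nat using (ℕ; _≤_; _<_; _+_; z≤n; s≤s)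
open import Data.Nat.Properties
  using (≤-trans; ≤-reflexive; m≤m+n; +-suc; +-monoʳ-≤; n≤1+n; ≮⇒≥; _<?_)
open import Data.Nat.Induction using (<-wellFounded)
open import Induction.WellFounded using (Acc; acc)
open import Data.Product using (∃; _×_; _,_; proj₁; proj₂)
open import Data.Vec using ([]; _∷_)
open import Data.Fin using (Fin; _≟_)
open import Data.Fin.Properties using (any?; all?; ¬∀⟶∃¬)
open import Data.Fin.Subset using (Subset; _∈_; _⊆_; _∪_; ⁅_⁆; ∣_∣; inside; outside)
open import Data.Fin.Subset.Properties using (_∈?_; anySubset?; p⊆p∪q; q⊆p∪q; x∈⁅x⁆; ∣⁅x⁆∣≡1)
open import Function using (_∘_)
open import Relation.Nullary using (¬_; Dec; yes; no; contradiction)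
open import Relation.Nullary.Decidable using (_×-dec_; _→-dec_; _⊎-dec_; ¬?; decidable-stable)
open import Relation.Binary.PropositionalEquality using (_≡_; refl; sym; subst)

∣p∪q∣≤∣p∣+∣q∣ : ∀ {n} (p q : Subset n) → ∣ p ∪ q ∣ ≤ ∣ p ∣ + ∣ q ∣
∣p∪q∣≤∣p∣+∣q∣ []            []            = z≤n
∣p∪q∣≤∣p∣+∣q∣ (inside ∷ p)  (inside ∷ q)  =
  s≤s (≤-trans (∣p∪q∣≤∣p∣+∣q∣ p q) (+-monoʳ-≤ ∣ p ∣ (n≤1+n ∣ q ∣)))
∣p∪q∣≤∣p∣+∣q∣ (inside ∷ p)  (outside ∷ q) = s≤s (∣p∪q∣≤∣p∣+∣q∣ p q)
∣p∪q∣≤∣p∣+∣q∣ (outside ∷ p) (inside ∷ q)  =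
  ≤-trans (s≤s (∣p∪q∣≤∣p∣+∣q∣ p q)) (≤-reflexive (sym (+-suc ∣ p ∣ ∣ q ∣)))
∣p∪q∣≤∣p∣+∣q∣ (outside ∷ p) (outside ∷ q) = ∣p∪q∣≤∣p∣+∣q∣ p q

∣p∪⁅x⁆∣≤∣p∣+1 : ∀ {n} (p : Subset n) x → ∣ p ∪ ⁅ x ⁆ ∣ ≤ ∣ p ∣ + 1
∣p∪⁅x⁆∣≤∣p∣+1 p x = subst (λ k → ∣ p ∪ ⁅ x ⁆ ∣ ≤ ∣ p ∣ + k) (∣⁅x⁆∣≡1 x) (∣p∪q∣≤∣p∣+∣q∣ p ⁅ x ⁆)

_⇔-dec_ : ∀ {A B : Set} → Dec A → Dec B → Dec ((A → B) × (B → A))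
a? ⇔-dec b? = (a? →-dec b?) ×-dec (b? →-dec a?)

module _ {n : ℕ} (G : Graph n) where
  open Graph G

  Dominated : Subset n → Fin n → Set
  Dominated C v = ∃ λ u → Adj v u × u ∈ C

  minCard-exists : {P : Subset n → Set} → (∀ C → Dec (P C)) → ∀ {C} → P C → ∃ (IsMinCard G P)
  minCard-exists {P} P? {C} pC = descend C pC (<-wellFounded ∣ C ∣)
    where
    descend : ∀ C → P C → Acc _<_ ∣ C ∣ → ∃ (IsMinCard G P)
    descend C pC (acc smaller) with anySubset? (λ D → P? D ×-dec (∣ D ∣ <? ∣ C ∣))
    ... | yes (D , pD , ∣D∣<∣C∣) = descend D pD (smaller ∣D∣<∣C∣)
    ... | no ¬smaller = ∣ C ∣ , (C , pC , refl) , λ D pD → ≮⇒≥ λ ∣D∣<∣C∣ → ¬smaller (D , pD , ∣D∣<∣C∣)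

  sameOpen? : ∀ C v w → Dec (SameOpen G C v w)
  sameOpen? C v w = all? λ u → (u ∈? C) →-dec (adj? v u ⇔-dec adj? w u)

  closedNbr? : ∀ v u → Dec (ClosedNbr G v u)
  closedNbr? v u = (u ≟ v) ⊎-dec adj? v u

  sameClosed? : ∀ C v w → Dec (SameClosed G C v w)
  sameClosed? C v w = all? λ u → (u ∈? C) →-dec (closedNbr? v u ⇔-dec closedNbr? w u)

  oSet? : ∀ C → Dec (OSet G C)
  oSet? C = all? λ v → all? λ w → sameOpen? C v w →-dec (v ≟ w)

  fSet? : ∀ C → Dec (FSet G C)
  fSet? C = oSet? C ×-dec (all? λ v → all? λ w → sameClosed? C v w →-dec (v ≟ w))

  sSet? : ∀ S C → Dec (SSet G S C)
  sSet? O = oSet?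
  sSet? F = fSet?

  dominated? : ∀ C v → Dec (Dominated C v)
  dominated? C v = any? λ u → adj? v u ×-dec (u ∈? C)

  totalDominating? : ∀ C → Dec (TotalDominating G C)
  totalDominating? C = all? (dominated? C)

  stdCode? : ∀ S C → Dec (STDCode G S C)
  stdCode? S C = sSet? S C ×-dec totalDominating? C

  sSet⇒oSet : ∀ S {C} → SSet G S C → OSet G C
  sSet⇒oSet O sep = sep
  sSet⇒oSet F sep = proj₁ sep

  sameOpen-⊆ : ∀ {C D v w} → C ⊆ D → SameOpen G D v w → SameOpen G C v w
  sameOpen-⊆ C⊆D same u u∈C = same u (C⊆D u∈C)

  sameClosed-⊆ : ∀ {C D v w} → C ⊆ D → SameClosed G D v w → SameClosed G C v w
  sameClosed-⊆ C⊆D same u u∈C = same u (C⊆D u∈C)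

  sSet-⊆ : ∀ S {C D} → C ⊆ D → SSet G S C → SSet G S D
  sSet-⊆ O C⊆D sep = λ v w → sep v w ∘ sameOpen-⊆ C⊆D
  sSet-⊆ F C⊆D (sep , closedSep) = sSet-⊆ O C⊆D sep , λ v w → closedSep v w ∘ sameClosed-⊆ C⊆D

  undominated-unique : ∀ {C v w} → OSet G C → ¬ Dominated C v → ¬ Dominated C w → v ≡ w
  undominated-unique sep ¬dv ¬dw = sep _ _ λ u u∈C →
    (λ vu → contradiction (u , vu , u∈C) ¬dv) , (λ wu → contradiction (u , wu , u∈C) ¬dw)

  neighbour : NoIsolated G → ∀ v → ∃ (Adj v)
  neighbour noIsolated v with ¬∀⟶∃¬ n _ (¬? ∘ adj? v) (noIsolated v)
  ... | u , ¬¬vu = u , decidable-stable (adj? v u) ¬¬vu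

  totalDominating-∪⁅⁆ : ∀ {C v u} → OSet G C → ¬ Dominated C v → Adj v u →
                        TotalDominating G (C ∪ ⁅ u ⁆)
  totalDominating-∪⁅⁆ {C} {v} {u} sep ¬dv vu w with dominated? C w
  ... | yes (x , wx , x∈C) = x , wx , p⊆p∪q ⁅ u ⁆ x∈C
  ... | no ¬dw rewrite undominated-unique sep ¬dw ¬dv = u , vu , q⊆p∪q C ⁅ u ⁆ (x∈⁅x⁆ u)

  sSet⇒stdCode : NoIsolated G → ∀ S {C} → SSet G S C →
                 ∃ λ D → STDCode G S D × ∣ D ∣ ≤ ∣ C ∣ + 1
  sSet⇒stdCode noIsolated S {C} sep with totalDominating? C
  ... | yes td = C , (sep , td) , m≤m+n ∣ C ∣ 1
  ... | no ¬td with ¬∀⟶∃¬ n _ (dominated? C) ¬td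
  ...   | v , ¬dv with neighbour noIsolated v
  ...     | u , vu = C ∪ ⁅ u ⁆
                   , (sSet-⊆ S (p⊆p∪q ⁅ u ⁆) sep , totalDominating-∪⁅⁆ (sSet⇒oSet S sep) ¬dv vu)
                   , ∣p∪⁅x⁆∣≤∣p∣+1 C u

theorem4 : (S : Sep) {n : ℕ} (G : Graph n) →
    Admissible G S → NoIsolated G →
    (∃ λ m → γSTD G S m) ×
    (∀ k m → γS G S k → γSTD G S m → m ≤ k + 1)
theorem4 S G (C , sep) noIsolated =
  minCard-exists G (stdCode? G S) (proj₁ (proj₂ (sSet⇒stdCode G noIsolated S sep))) ,
  λ { k m ((C′ , sep′ , refl) , _) (_ , stdMinimal) →
        let D , stdD , ∣D∣≤∣C′∣+1 = sSet⇒stdCode G noIsolated S sep′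
        in ≤-trans (stdMinimal D stdD) ∣D∣≤∣C′∣+1 }
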